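{- Let $L$ be a $\mathbb Z$-lattice and $n$ a positive integer. If $\min(L)\in\{n,n+1\}$ and $L$ represents every integer $m$ with $n+1\le m\le 2n-1$, then the $\mathbb Z$-lattice $\langle n,n,n,n\rangle\perp L$ is tight $\mathcal T(n)$-universal, and hence $t(n)\le\operatorname{rank}(L)+4$.
   Context: A $\mathbb Z$-lattice is a free $\mathbb Z$-module of finite rank equipped with a positive definite symmetric bilinear form with values in $\mathbb Z$; $Q(\bm x)=B(\bm x,\bm x)$. $\min(L)=\min\{Q(\bm x):\bm x\in L,\ \bm x\ne 0\}$. $\langle a_1,\dots,a_k\rangle$ is $\mathbb Z^k$ with $Q(x)=\sum a_ix_i^2$, and $\perp$ denotes orthogonal direct sum. An integer $m$ is represented by $L$ if $m=Q(\bm x)$ for some $\bm x\in L$. $\mathcal T(n)$ is the set of integers $\ge n$; $L$ is tight $\mathcal T(n)$-universal if the set of nonzero integers represented by $L$ is exactly $\mathcal T(n)$. $t(n)$ is the smallest rank of a tight $\mathcal T(n)$-universal $\mathbb Z$-lattice. -}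

module Defs where

open import Data.Nat using (ℕ; zero; suc) renaming (_+_ to _+ℕ_)
open import Data.Integer using (ℤ; +_; _+_; _*_; _≤_; _<_; 0ℤ)
open import Data.Fin using (Fin; zero; suc; splitAt)
open import Data.Sum using (_⊎_; inj₁; inj₂)
open import Data.Product using (Σ; ∃; _×_; _,_)
open import Relation.Binary.PropositionalEquality using (_≡_)
open import Relation.Nullary using (¬_)
open import Function.Bundles using (_⇔_)

ΣFin : (k : ℕ) → (Fin k → ℤ) → ℤ
ΣFin zero    f = 0ℤ
ΣFin (suc k) f = f zero + ΣFin k (λ i → f (suc i))

-- A Gram matrix of rank k (the bilinear form B on the basis of ℤ^k).
Gram : ℕ → Set
Gram k = Fin k → Fin k → ℤ

Q : {k : ℕ} → Gram k → (Fin k → ℤ) → ℤ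
Q {k} G x = ΣFin k (λ i → ΣFin k (λ j → G i j * (x i * x j)))

NonZeroVec : {k : ℕ} → (Fin k → ℤ) → Set
NonZeroVec x = ¬ (∀ i → x i ≡ 0ℤ)

record IsZLattice {k : ℕ} (G : Gram k) : Set where
  field
    symmetric : ∀ i j → G i j ≡ G j i
    posDef    : ∀ (x : Fin k → ℤ) → NonZeroVec x → 0ℤ < Q G x

Represents : {k : ℕ} → Gram k → ℤ → Set
Represents G m = ∃ λ x → Q G x ≡ m

IsMin : {k : ℕ} → Gram k → ℤ → Set
IsMin G m = (∃ λ x → NonZeroVec x × Q G x ≡ m)
          × (∀ x → NonZeroVec x → m ≤ Q G x)

_⊥_ : {a b : ℕ} → Gram a → Gram b → Gram (a +ℕ b)
_⊥_ {a} G H i j with splitAt a i | splitAt a j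
... | inj₁ i' | inj₁ j' = G i' j'
... | inj₂ i' | inj₂ j' = H i' j'
... | inj₁ _  | inj₂ _  = 0ℤ
... | inj₂ _  | inj₁ _  = 0ℤ

diag4 : ℤ → Gram 4
diag4 n i j with i Data.Fin.≟ j
... | Relation.Nullary.yes _ = n
... | Relation.Nullary.no _  = 0ℤ

TightUniversal : {k : ℕ} → ℤ → Gram k → Set
TightUniversal n G = ∀ (m : ℤ) → ¬ (m ≡ 0ℤ) → (Represents G m ⇔ n ≤ m)

-- t(n) ≤ r : there is a tight T(n)-universal ℤ-lattice of rank ≤ r
-- (t(n) is the least such rank, so this is exactly "t(n) ≤ r").
t≤ : ℤ → ℕ → Set
t≤ n r = Σ ℕ λ k → (k Data.Nat.≤ r) × Σ (Gram k) λ G → IsZLattice G × TightUniversal n G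

-- Every m ≥ n can be written n·a + b with a ≥ 0 and b = 0 or n < b < 2n. By Lagrange's theorem
-- n·a is a value of ⟨n,n,n,n⟩, and b is a value of L by hypothesis, so ⟨n,n,n,n⟩ ⊥ L represents
-- every m ≥ n. Conversely a nonzero vector is nonzero either in the ⟨n,n,n,n⟩ part, which then
-- contributes at least n, or in the L part, which contributes at least min(L) ≥ n.
-- Lagrange's theorem is proved by Euler's descent: an odd prime p has a multiple
-- m p = x² + y² + 1 with m < p (pigeonhole on squares mod p), and a representation of m p as a
-- sum of four squares with 1 < m < p yields one of r p with r < m: by halving when m is even,
-- and by Euler's identity applied to the residues of the squares mod m when m is odd.
module Submission where

open import Defs
open import Data.Nat using (ℕ; suc) renaming (_+_ to _+ℕ_)
open import Data.Integer using (ℤ; +_; _+_; _-_; _*_; _≤_)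
open import Data.Sum using (_⊎_)
open import Data.Product using (_×_)

open import Data.Fin as Fin using (Fin; zero; suc; toℕ; fromℕ<; splitAt; join; _↑ˡ_; _↑ʳ_)
import Data.Fin.Properties as Finₚ
open import Data.Integer as ℤ using (-_; -[1+_]; ∣_∣; _⊖_; 0ℤ; 1ℤ; +≤+; +<+)
open import Data.Integer.DivMod using (_/ℕ_; _%ℕ_; a≡a%ℕn+[a/ℕn]*n; n%ℕd<d)
import Data.Integer.Properties as ℤₚ
open import Data.Integer.Tactic.RingSolver using (solve-∀; solve)
open import Data.List using (_∷_; [])
open import Data.List.Relation.Unary.All as All using (All)
open import Data.Nat.Induction using (<-rec)
open import Data.Nat.Divisibility using (_∣_; divides; >⇒∤)
open import Data.Nat.ListAction using (product)
open import Data.Nat.Primality using (Prime; composite; euclidsLemma; ¬prime[0]; ¬prime[1])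
open import Data.Nat.Primality.Factorisation using (PrimeFactorisation; factorise)
import Data.Nat as ℕ
import Data.Nat.Properties as ℕₚ
open import Data.Nat.DivMod using (_%_; _/_; m≡m%n+[m/n]*n; m%n<n)
open import Data.Nat.Tactic.RingSolver using () renaming (solve-∀ to ℕ-solve-∀)
open import Data.Product using (∃-syntax; _,_)
open import Data.Sum using (inj₁; inj₂)
open import Data.Vec.Functional as Vector using (Vector; _++_; take; drop)
open import Data.Vec.Functional.Properties using (lookup-++ˡ; lookup-++ʳ)
open import Function using (_∘_)
open import Function.Bundles using (mk⇔)
open import Relation.Binary.PropositionalEquality
open import Relation.Nullary using (¬_; contradiction; yes; no)

open ≡-Reasoning

-- Lagrange's four-square theorem

IsSumOfFourSquares : ℤ → Set
IsSumOfFourSquares N = ∃[ a ] ∃[ b ] ∃[ c ] ∃[ d ] a * a + b * b + c * c + d * d ≡ N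

euler-four-square-identity : ∀ a b c d e f g h →
  (a * a + b * b + c * c + d * d) * (e * e + f * f + g * g + h * h) ≡
  (a * e + b * f + c * g + d * h) * (a * e + b * f + c * g + d * h)
  + (a * f - b * e + c * h - d * g) * (a * f - b * e + c * h - d * g)
  + (a * g - b * h - c * e + d * f) * (a * g - b * h - c * e + d * f)
  + (a * h + b * g - c * f - d * e) * (a * h + b * g - c * f - d * e)
euler-four-square-identity = solve-∀

sumOfFourSquares-* : ∀ {A B} → IsSumOfFourSquares A → IsSumOfFourSquares B →
                     IsSumOfFourSquares (A * B)
sumOfFourSquares-* (a , b , c , d , refl) (e , f , g , h , refl) =
  a * e + b * f + c * g + d * h , a * f - b * e + c * h - d * g ,
  a * g - b * h - c * e + d * f , a * h + b * g - c * f - d * e ,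
  sym (euler-four-square-identity a b c d e f g h)

Even : ℤ → Set
Even x = ∃[ q ] x ≡ q + q

Odd : ℤ → Set
Odd x = ∃[ q ] x ≡ q + q + 1ℤ

even⊎odd : ∀ x → Even x ⊎ Odd x
even⊎odd x = from-remainder (x %ℕ 2) (x /ℕ 2) (n%ℕd<d x 2) (a≡a%ℕn+[a/ℕn]*n x 2)
  where
  from-remainder : ∀ r q → r ℕ.< 2 → x ≡ + r + q * + 2 → Even x ⊎ Odd x
  from-remainder 0 q _ x≡ = inj₁ (q , trans x≡ (solve (q ∷ [])))
  from-remainder 1 q _ x≡ = inj₂ (q , trans x≡ (solve (q ∷ [])))
  from-remainder (suc (suc _)) _ (ℕ.s≤s (ℕ.s≤s ())) _

even⇒¬odd : ∀ {x} → Even x → ¬ Odd x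
even⇒¬odd (q , refl) (r , q+q≡2r+1) = 2≢1 (ℕₚ.m*n≡1⇒m≡1 2 ∣ q - r ∣ (begin
  2 ℕ.* ∣ q - r ∣       ≡⟨ ℤₚ.abs-* (+ 2) (q - r) ⟨
  ∣ + 2 * (q - r) ∣     ≡⟨ cong ∣_∣ twice[q-r]≡1 ⟩
  1                     ∎))
  where
  2≢1 : ¬ 2 ≡ 1
  2≢1 ()
  twice[q-r]≡1 : + 2 * (q - r) ≡ 1ℤ
  twice[q-r]≡1 = begin
    + 2 * (q - r)            ≡⟨ solve (q ∷ r ∷ []) ⟩
    (q + q) - (r + r)        ≡⟨ cong (_- (r + r)) q+q≡2r+1 ⟩
    r + r + 1ℤ - (r + r)     ≡⟨ solve (r ∷ []) ⟩
    1ℤ                       ∎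

even-square⇒even : ∀ x → Even (x * x) → Even x
even-square⇒even x x²-even with even⊎odd x
... | inj₁ x-even     = x-even
... | inj₂ (q , refl) = contradiction (q * q + q * q + q + q , square-odd) (even⇒¬odd x²-even)
  where
  square-odd : (q + q + 1ℤ) * (q + q + 1ℤ) ≡ (q * q + q * q + q + q) + (q * q + q * q + q + q) + 1ℤ
  square-odd = solve (q ∷ [])

sumOfTwoSquares-even⇒even-diff : ∀ x y S → x * x + y * y ≡ + 2 * S → Even (x - y)
sumOfTwoSquares-even⇒even-diff x y S x²+y²≡2S =
  even-square⇒even (x - y) (S - x * y , (begin
    (x - y) * (x - y)              ≡⟨ solve (x ∷ y ∷ []) ⟩
    x * x + y * y - + 2 * (x * y)  ≡⟨ cong (_- + 2 * (x * y)) x²+y²≡2S ⟩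
    + 2 * S - + 2 * (x * y)        ≡⟨ solve (S ∷ x ∷ y ∷ []) ⟩
    S - x * y + (S - x * y)        ∎))

even-diff⇒sumOfTwoSquares-half : ∀ x y → Even (x - y) →
  ∃[ u ] ∃[ v ] x * x + y * y ≡ + 2 * (u * u + v * v)
even-diff⇒sumOfTwoSquares-half x y (v , x-y≡2v) = y + v , v , (begin
  x * x + y * y                                       ≡⟨ cong (λ z → z * z + y * y) x≡y+2v ⟩
  (y + (v + v)) * (y + (v + v)) + y * y               ≡⟨ solve (y ∷ v ∷ []) ⟩
  + 2 * ((y + v) * (y + v) + v * v)                   ∎)
  where
  x≡y+2v : x ≡ y + (v + v)
  x≡y+2v = begin
    x             ≡⟨ solve (x ∷ y ∷ []) ⟩
    y + (x - y)   ≡⟨ cong (λ z → y + z) x-y≡2v ⟩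
    y + (v + v)   ∎

two-of-three-even-diff : ∀ a b c → Even (a - b) ⊎ Even (a - c) ⊎ Even (b - c)
two-of-three-even-diff a b c with even⊎odd (a - b) | even⊎odd (a - c)
... | inj₁ ab-even | _           = inj₁ ab-even
... | inj₂ _       | inj₁ ac-even = inj₂ (inj₁ ac-even)
... | inj₂ (q , a-b≡2q+1) | inj₂ (r , a-c≡2r+1) = inj₂ (inj₂ (r - q , (begin
  b - c                              ≡⟨ solve (a ∷ b ∷ c ∷ []) ⟩
  (a - c) - (a - b)                  ≡⟨ cong₂ _-_ a-c≡2r+1 a-b≡2q+1 ⟩
  (r + r + 1ℤ) - (q + q + 1ℤ)        ≡⟨ solve (q ∷ r ∷ []) ⟩
  r - q + (r - q)                    ∎)))

twice-sum-cancel : ∀ {A B S T} → A + B ≡ + 2 * T → A ≡ + 2 * S → B ≡ + 2 * (T - S)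
twice-sum-cancel {A} {B} {S} {T} A+B≡2T A≡2S = begin
  B                        ≡⟨ solve (A ∷ B ∷ []) ⟩
  (A + B) - A              ≡⟨ cong₂ _-_ A+B≡2T A≡2S ⟩
  + 2 * T - + 2 * S        ≡⟨ solve (T ∷ S ∷ []) ⟩
  + 2 * (T - S)            ∎

sumOfFourSquares≡half : ∀ {A B T} u v u′ v′ → A ≡ + 2 * (u * u + v * v) →
  B ≡ + 2 * (u′ * u′ + v′ * v′) → A + B ≡ + 2 * T → u * u + v * v + u′ * u′ + v′ * v′ ≡ T
sumOfFourSquares≡half {A} {B} {T} u v u′ v′ A≡2[u²+v²] B≡2[u′²+v′²] A+B≡2T =
  ℤₚ.*-cancelˡ-≡ (+ 2) _ _ (begin
    + 2 * (u * u + v * v + u′ * u′ + v′ * v′)          ≡⟨ solve (u ∷ v ∷ u′ ∷ v′ ∷ []) ⟩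
    + 2 * (u * u + v * v) + + 2 * (u′ * u′ + v′ * v′)  ≡⟨ cong₂ _+_ A≡2[u²+v²] B≡2[u′²+v′²] ⟨
    A + B                                              ≡⟨ A+B≡2T ⟩
    + 2 * T                                            ∎)

sumOfFourSquares-half-paired : ∀ a b c d T → Even (a - b) →
  (a * a + b * b) + (c * c + d * d) ≡ + 2 * T → IsSumOfFourSquares T
sumOfFourSquares-half-paired a b c d T ab-even sum≡2T =
  let u , v , a²+b²≡2[u²+v²] = even-diff⇒sumOfTwoSquares-half a b ab-even
      cd-even = sumOfTwoSquares-even⇒even-diff c d _ (twice-sum-cancel sum≡2T a²+b²≡2[u²+v²])
      u′ , v′ , c²+d²≡2[u′²+v′²] = even-diff⇒sumOfTwoSquares-half c d cd-even
  in u , v , u′ , v′ , sumOfFourSquares≡half u v u′ v′ a²+b²≡2[u²+v²] c²+d²≡2[u′²+v′²] sum≡2T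

sumOfFourSquares-half : ∀ T → IsSumOfFourSquares (+ 2 * T) → IsSumOfFourSquares T
sumOfFourSquares-half T (a , b , c , d , sum≡2T) with two-of-three-even-diff a b c
... | inj₁ ab-even = sumOfFourSquares-half-paired a b c d T ab-even (begin
  (a * a + b * b) + (c * c + d * d)  ≡⟨ solve (a ∷ b ∷ c ∷ d ∷ []) ⟩
  a * a + b * b + c * c + d * d      ≡⟨ sum≡2T ⟩
  + 2 * T                            ∎)
... | inj₂ (inj₁ ac-even) = sumOfFourSquares-half-paired a c b d T ac-even (begin
  (a * a + c * c) + (b * b + d * d)  ≡⟨ solve (a ∷ b ∷ c ∷ d ∷ []) ⟩
  a * a + b * b + c * c + d * d      ≡⟨ sum≡2T ⟩
  + 2 * T                            ∎)
... | inj₂ (inj₂ bc-even) = sumOfFourSquares-half-paired b c a d T bc-even (begin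
  (b * b + c * c) + (a * a + d * d)  ≡⟨ solve (a ∷ b ∷ c ∷ d ∷ []) ⟩
  a * a + b * b + c * c + d * d      ≡⟨ sum≡2T ⟩
  + 2 * T                            ∎)

multiple-below⇒zero : ∀ {p n} → p ∣ n → n ℕ.< p → n ≡ 0
multiple-below⇒zero {n = 0}     _   _   = refl
multiple-below⇒zero {n = suc _} p∣n n<p = contradiction p∣n (>⇒∤ n<p)

a%ℕp≡b%ℕp⇒p∣∣a-b∣ : ∀ p .{{_ : ℕ.NonZero p}} a b → a %ℕ p ≡ b %ℕ p → p ∣ ∣ a - b ∣
a%ℕp≡b%ℕp⇒p∣∣a-b∣ p a b a%p≡b%p = divides ∣ a /ℕ p - b /ℕ p ∣ (begin
  ∣ a - b ∣                                                ≡⟨ cong ∣_∣ a-b≡[a/p-b/p]*p ⟩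
  ∣ (a /ℕ p - b /ℕ p) * + p ∣                              ≡⟨ ℤₚ.abs-* (a /ℕ p - b /ℕ p) (+ p) ⟩
  ∣ a /ℕ p - b /ℕ p ∣ ℕ.* p                                ∎)
  where
  cancel-remainder : ∀ r s t P → (r + s * P) - (r + t * P) ≡ (s - t) * P
  cancel-remainder = solve-∀
  a-b≡[a/p-b/p]*p : a - b ≡ (a /ℕ p - b /ℕ p) * + p
  a-b≡[a/p-b/p]*p = begin
    a - b
      ≡⟨ cong₂ _-_ (a≡a%ℕn+[a/ℕn]*n a p) (a≡a%ℕn+[a/ℕn]*n b p) ⟩
    (+ (a %ℕ p) + a /ℕ p * + p) - (+ (b %ℕ p) + b /ℕ p * + p)
      ≡⟨ cong (λ r → (+ r + a /ℕ p * + p) - (+ (b %ℕ p) + b /ℕ p * + p)) a%p≡b%p ⟩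
    (+ (b %ℕ p) + a /ℕ p * + p) - (+ (b %ℕ p) + b /ℕ p * + p)
      ≡⟨ cancel-remainder (+ (b %ℕ p)) (a /ℕ p) (b /ℕ p) (+ p) ⟩
    (a /ℕ p - b /ℕ p) * + p
      ∎

square-injective-mod-prime : ∀ {h x y} → Prime (suc (h ℕ.+ h)) → x ℕ.≤ h → y ℕ.≤ h →
  suc (h ℕ.+ h) ∣ ∣ + x * + x - + y * + y ∣ → x ≡ y
square-injective-mod-prime {h} {x} {y} p-prime x≤h y≤h p∣x²-y²
  with euclidsLemma ∣ + x - + y ∣ (x ℕ.+ y) p-prime p∣[x-y][x+y]
  where
  difference-of-squares : ∀ a b → a * a - b * b ≡ (a - b) * (a + b)
  difference-of-squares = solve-∀
  p∣[x-y][x+y] : suc (h ℕ.+ h) ∣ ∣ + x - + y ∣ ℕ.* (x ℕ.+ y)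
  p∣[x-y][x+y] = subst (suc (h ℕ.+ h) ∣_) (begin
    ∣ + x * + x - + y * + y ∣           ≡⟨ cong ∣_∣ (difference-of-squares (+ x) (+ y)) ⟩
    ∣ (+ x - + y) * (+ x + + y) ∣       ≡⟨ ℤₚ.abs-* (+ x - + y) (+ x + + y) ⟩
    ∣ + x - + y ∣ ℕ.* (x ℕ.+ y)         ∎) p∣x²-y²
... | inj₁ p∣x-y = ℤₚ.+-injective (ℤₚ.i-j≡0⇒i≡j (+ x) (+ y) (ℤₚ.∣i∣≡0⇒i≡0
  (multiple-below⇒zero p∣x-y (ℕ.s≤s (ℕₚ.≤-trans ∣x-y∣≤h (ℕₚ.m≤m+n h h))))))
  where
  ∣x-y∣≤h : ∣ + x - + y ∣ ℕ.≤ h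
  ∣x-y∣≤h = subst (ℕ._≤ h) (cong ∣_∣ (sym (ℤₚ.m-n≡m⊖n x y)))
    (ℕₚ.≤-trans (ℤₚ.∣m⊝n∣≤m⊔n x y) (ℕₚ.⊔-lub x≤h y≤h))
... | inj₂ p∣x+y = trans (ℕₚ.m+n≡0⇒m≡0 x x+y≡0) (sym (ℕₚ.m+n≡0⇒n≡0 x x+y≡0))
  where
  x+y≡0 : x ℕ.+ y ≡ 0
  x+y≡0 = multiple-below⇒zero p∣x+y (ℕ.s≤s (ℕₚ.+-mono-≤ x≤h y≤h))

-- The h + 1 values x² and the h + 1 values -1 - y² (0 ≤ x, y ≤ h) cannot all be distinct
-- modulo p = 2h + 1; the squares are distinct among themselves, so some x² ≡ -1 - y².
minus-one-sumOfTwoSquares-mod-prime : ∀ h → Prime (suc (h ℕ.+ h)) →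
  ∃[ x ] ∃[ y ] x ℕ.≤ h × y ℕ.≤ h × suc (h ℕ.+ h) ∣ x ℕ.* x ℕ.+ y ℕ.* y ℕ.+ 1
minus-one-sumOfTwoSquares-mod-prime h p-prime =
  let i , j , i<j , fi≡fj = Finₚ.pigeonhole p<2[h+1] (residue ∘ candidate ∘ splitAt (suc h))
      s = splitAt (suc h) i
      t = splitAt (suc h) j
  in collision s t (λ s≡t → Finₚ.<⇒≢ i<j (splitAt-injective s≡t))
       (a%ℕp≡b%ℕp⇒p∣∣a-b∣ p (candidate s) (candidate t)
         (trans (sym (Finₚ.toℕ-fromℕ< _)) (trans (cong toℕ fi≡fj) (Finₚ.toℕ-fromℕ< _))))
  where
  p = suc (h ℕ.+ h)
  Result = ∃[ x ] ∃[ y ] x ℕ.≤ h × y ℕ.≤ h × p ∣ x ℕ.* x ℕ.+ y ℕ.* y ℕ.+ 1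

  p<2[h+1] : p ℕ.< suc h ℕ.+ suc h
  p<2[h+1] = ℕ.s≤s (ℕₚ.≤-reflexive (sym (ℕₚ.+-suc h h)))

  residue : ℤ → Fin p
  residue a = fromℕ< (n%ℕd<d a p)

  candidate : Fin (suc h) ⊎ Fin (suc h) → ℤ
  candidate (inj₁ x) = + toℕ x * + toℕ x
  candidate (inj₂ y) = - 1ℤ - + toℕ y * + toℕ y

  splitAt-injective : ∀ {i j} → splitAt (suc h) i ≡ splitAt (suc h) j → i ≡ j
  splitAt-injective {i} {j} si≡sj = begin
    i                                   ≡⟨ Finₚ.join-splitAt (suc h) (suc h) i ⟨
    join (suc h) (suc h) (splitAt _ i)  ≡⟨ cong (join (suc h) (suc h)) si≡sj ⟩
    join (suc h) (suc h) (splitAt _ j)  ≡⟨ Finₚ.join-splitAt (suc h) (suc h) j ⟩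
    j                                   ∎

  bound : (x : Fin (suc h)) → toℕ x ℕ.≤ h
  bound x = ℕ.s≤s⁻¹ (Finₚ.toℕ<n x)

  ∣x²+y²+1∣ : ∀ x y → ∣ + x * + x + + y * + y + 1ℤ ∣ ≡ x ℕ.* x ℕ.+ y ℕ.* y ℕ.+ 1
  ∣x²+y²+1∣ x y rewrite sym (ℤₚ.pos-* x x) | sym (ℤₚ.pos-* y y) = refl

  candidate₂-diff : ∀ a b → (- 1ℤ - a * a) - (- 1ℤ - b * b) ≡ b * b - a * a
  candidate₂-diff = solve-∀

  candidate₁₂-diff : ∀ a b → a * a - (- 1ℤ - b * b) ≡ a * a + b * b + 1ℤ
  candidate₁₂-diff = solve-∀

  collision : ∀ s t → s ≢ t → p ∣ ∣ candidate s - candidate t ∣ → Result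
  collision (inj₁ x) (inj₁ x′) s≢t p∣ =
    contradiction (cong inj₁ (Finₚ.toℕ-injective
      (square-injective-mod-prime p-prime (bound x) (bound x′) p∣))) s≢t
  collision (inj₂ y) (inj₂ y′) s≢t p∣ =
    contradiction (cong inj₂ (Finₚ.toℕ-injective (sym
      (square-injective-mod-prime p-prime (bound y′) (bound y)
        (subst (p ∣_) (cong ∣_∣ (candidate₂-diff (+ toℕ y) (+ toℕ y′))) p∣))))) s≢t
  collision (inj₁ x) (inj₂ y) _ p∣ = toℕ x , toℕ y , bound x , bound y ,
    subst (p ∣_) (trans (cong ∣_∣ (candidate₁₂-diff (+ toℕ x) (+ toℕ y)))
                        (∣x²+y²+1∣ (toℕ x) (toℕ y))) p∣
  collision (inj₂ y) (inj₁ x) s≢t p∣ = collision (inj₁ x) (inj₂ y) (s≢t ∘ sym)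
    (subst (p ∣_) (ℤₚ.∣i-j∣≡∣j-i∣ (candidate (inj₂ y)) (candidate (inj₁ x))) p∣)

i*i≡+∣i∣*∣i∣ : ∀ i → i * i ≡ + (∣ i ∣ ℕ.* ∣ i ∣)
i*i≡+∣i∣*∣i∣ (+ n)    = sym (ℤₚ.pos-* n n)
i*i≡+∣i∣*∣i∣ -[1+ n ] = refl

sumOfFourSquares≡sumOfAbsSquares : ∀ a b c d →
  a * a + b * b + c * c + d * d ≡
  + (∣ a ∣ ℕ.* ∣ a ∣ ℕ.+ ∣ b ∣ ℕ.* ∣ b ∣ ℕ.+ ∣ c ∣ ℕ.* ∣ c ∣ ℕ.+ ∣ d ∣ ℕ.* ∣ d ∣)
sumOfFourSquares≡sumOfAbsSquares a b c d
  rewrite i*i≡+∣i∣*∣i∣ a | i*i≡+∣i∣*∣i∣ b | i*i≡+∣i∣*∣i∣ c | i*i≡+∣i∣*∣i∣ d = refl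

sumOfFourSquares≡0 : ∀ a b c d → a ℕ.* a ℕ.+ b ℕ.* b ℕ.+ c ℕ.* c ℕ.+ d ℕ.* d ≡ 0 →
  a ≡ 0 × b ≡ 0 × c ≡ 0 × d ≡ 0
sumOfFourSquares≡0 0 0 0 0 _ = refl , refl , refl , refl

sumOfFourSquares<square : ∀ {h a b c d} → a ℕ.≤ h → b ℕ.≤ h → c ℕ.≤ h → d ℕ.≤ h →
  a ℕ.* a ℕ.+ b ℕ.* b ℕ.+ c ℕ.* c ℕ.+ d ℕ.* d ℕ.< suc (h ℕ.+ h) ℕ.* suc (h ℕ.+ h)
sumOfFourSquares<square {h} a≤h b≤h c≤h d≤h = ℕₚ.≤-<-trans
  (ℕₚ.+-mono-≤ (ℕₚ.+-mono-≤ (ℕₚ.+-mono-≤ (square-mono a≤h) (square-mono b≤h)) (square-mono c≤h))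
               (square-mono d≤h))
  (ℕₚ.≤-trans (ℕ.s≤s (ℕₚ.m≤m+n _ (h ℕ.+ h ℕ.+ h ℕ.+ h))) (ℕₚ.≤-reflexive (square-of-odd h)))
  where
  square-of-odd : ∀ h → suc (h ℕ.* h ℕ.+ h ℕ.* h ℕ.+ h ℕ.* h ℕ.+ h ℕ.* h ℕ.+ (h ℕ.+ h ℕ.+ h ℕ.+ h)) ≡
                                   suc (h ℕ.+ h) ℕ.* suc (h ℕ.+ h)
  square-of-odd = ℕ-solve-∀
  square-mono : ∀ {t} → t ℕ.≤ h → t ℕ.* t ℕ.≤ h ℕ.* h
  square-mono t≤h = ℕₚ.*-mono-≤ t≤h t≤h

keep-quotient : ∀ r q m → r + q * m ≡ r + m * q
keep-quotient = solve-∀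

raise-quotient : ∀ r q m → r + q * m ≡ r - m + m * (q + 1ℤ)
raise-quotient = solve-∀

SmallResidue : ℕ → ℕ → ℤ → Set
SmallResidue m h x = ∃[ y ] ∃[ k ] x ≡ y + + m * k × ∣ y ∣ ℕ.≤ h

small-residue : ∀ m h x .{{_ : ℕ.NonZero m}} → m ℕ.≤ suc (h ℕ.+ h) → SmallResidue m h x
small-residue m h x m≤2h+1 with x %ℕ m ℕ.≤? h
... | yes r≤h = + (x %ℕ m) , x /ℕ m ,
  trans (a≡a%ℕn+[a/ℕn]*n x m) (keep-quotient (+ (x %ℕ m)) (x /ℕ m) (+ m)) , r≤h
... | no r≰h = + (x %ℕ m) - + m , x /ℕ m + 1ℤ ,
  trans (a≡a%ℕn+[a/ℕn]*n x m) (raise-quotient (+ (x %ℕ m)) (x /ℕ m) (+ m)) ,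
  ℕₚ.≤-trans (ℕₚ.≤-reflexive ∣r-m∣≡m∸r)
             (ℕₚ.≤-trans (ℕₚ.∸-mono m≤2h+1 (ℕₚ.≰⇒> r≰h)) (ℕₚ.≤-reflexive (ℕₚ.m+n∸n≡m h h)))
  where
  ∣r-m∣≡m∸r : ∣ + (x %ℕ m) - + m ∣ ≡ m ℕ.∸ x %ℕ m
  ∣r-m∣≡m∸r = begin
    ∣ + (x %ℕ m) - + m ∣   ≡⟨ ℤₚ.∣i-j∣≡∣j-i∣ (+ (x %ℕ m)) (+ m) ⟩
    ∣ + m - + (x %ℕ m) ∣   ≡⟨ cong ∣_∣ (ℤₚ.m-n≡m⊖n m (x %ℕ m)) ⟩
    ∣ m ⊖ x %ℕ m ∣         ≡⟨ cong ∣_∣ (ℤₚ.⊖-≥ (ℕₚ.<⇒≤ (n%ℕd<d x m))) ⟩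
    m ℕ.∸ x %ℕ m           ∎

-- Euler's identity for (Σ (yᵢ + M kᵢ)²)(Σ yᵢ²): the last three entries are visibly multiples of
-- M, and so is the first once Σ yᵢ² is known to be one.
euler-four-square-identity-congruent : ∀ y₁ y₂ y₃ y₄ k₁ k₂ k₃ k₄ M →
  ((y₁ + M * k₁) * (y₁ + M * k₁) + (y₂ + M * k₂) * (y₂ + M * k₂)
   + (y₃ + M * k₃) * (y₃ + M * k₃) + (y₄ + M * k₄) * (y₄ + M * k₄))
  * (y₁ * y₁ + y₂ * y₂ + y₃ * y₃ + y₄ * y₄)
  ≡ ((y₁ * y₁ + y₂ * y₂ + y₃ * y₃ + y₄ * y₄) + M * (k₁ * y₁ + k₂ * y₂ + k₃ * y₃ + k₄ * y₄))
    * ((y₁ * y₁ + y₂ * y₂ + y₃ * y₃ + y₄ * y₄) + M * (k₁ * y₁ + k₂ * y₂ + k₃ * y₃ + k₄ * y₄))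
  + (M * (k₁ * y₂ - k₂ * y₁ + k₃ * y₄ - k₄ * y₃)) * (M * (k₁ * y₂ - k₂ * y₁ + k₃ * y₄ - k₄ * y₃))
  + (M * (k₁ * y₃ - k₂ * y₄ - k₃ * y₁ + k₄ * y₂)) * (M * (k₁ * y₃ - k₂ * y₄ - k₃ * y₁ + k₄ * y₂))
  + (M * (k₁ * y₄ + k₂ * y₃ - k₃ * y₂ - k₄ * y₁)) * (M * (k₁ * y₄ + k₂ * y₃ - k₃ * y₂ - k₄ * y₁))
euler-four-square-identity-congruent = solve-∀

sumOfFourSquares-descent-identity : ∀ M {P R} y₁ y₂ y₃ y₄ k₁ k₂ k₃ k₄ .{{_ : ℤ.NonZero M}} →
  (y₁ + M * k₁) * (y₁ + M * k₁) + (y₂ + M * k₂) * (y₂ + M * k₂)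
   + (y₃ + M * k₃) * (y₃ + M * k₃) + (y₄ + M * k₄) * (y₄ + M * k₄) ≡ M * P →
  y₁ * y₁ + y₂ * y₂ + y₃ * y₃ + y₄ * y₄ ≡ M * R → IsSumOfFourSquares (R * P)
sumOfFourSquares-descent-identity M {P} {R} y₁ y₂ y₃ y₄ k₁ k₂ k₃ k₄ Σx²≡MP Σy²≡MR =
  R + s₁ , s₂ , s₃ , s₄ , ℤₚ.*-cancelˡ-≡ (M * M) _ _ {{ℤₚ.i*j≢0 M M}} (begin
    (M * M) * ((R + s₁) * (R + s₁) + s₂ * s₂ + s₃ * s₃ + s₄ * s₄)
      ≡⟨ distribute M R s₁ s₂ s₃ s₄ ⟩
    (M * R + M * s₁) * (M * R + M * s₁) + (M * s₂) * (M * s₂) + (M * s₃) * (M * s₃) + (M * s₄) * (M * s₄)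
      ≡⟨ cong (λ Y → (Y + M * s₁) * (Y + M * s₁) + (M * s₂) * (M * s₂) + (M * s₃) * (M * s₃)
                     + (M * s₄) * (M * s₄)) Σy²≡MR ⟨
    _ ≡⟨ euler-four-square-identity-congruent y₁ y₂ y₃ y₄ k₁ k₂ k₃ k₄ M ⟨
    _ ≡⟨ cong₂ _*_ Σx²≡MP Σy²≡MR ⟩
    (M * P) * (M * R)
      ≡⟨ solve (M ∷ P ∷ R ∷ []) ⟩
    (M * M) * (R * P) ∎)
  where
  s₁ = k₁ * y₁ + k₂ * y₂ + k₃ * y₃ + k₄ * y₄
  s₂ = k₁ * y₂ - k₂ * y₁ + k₃ * y₄ - k₄ * y₃
  s₃ = k₁ * y₃ - k₂ * y₄ - k₃ * y₁ + k₄ * y₂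
  s₄ = k₁ * y₄ + k₂ * y₃ - k₃ * y₂ - k₄ * y₁
  distribute : ∀ M R t₁ t₂ t₃ t₄ →
    (M * M) * ((R + t₁) * (R + t₁) + t₂ * t₂ + t₃ * t₃ + t₄ * t₄) ≡
    (M * R + M * t₁) * (M * R + M * t₁) + (M * t₂) * (M * t₂) + (M * t₃) * (M * t₃) + (M * t₄) * (M * t₄)
  distribute = solve-∀

a+m*c≡m*p⇒a≡m*[p-c] : ∀ {a m c p} → a + m * c ≡ m * p → a ≡ m * (p - c)
a+m*c≡m*p⇒a≡m*[p-c] {a} {m} {c} {p} a+mc≡mp = begin
  a                  ≡⟨ solve (a ∷ m ∷ c ∷ []) ⟩
  (a + m * c) - m * c ≡⟨ cong (_- m * c) a+mc≡mp ⟩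
  m * p - m * c      ≡⟨ solve (m ∷ p ∷ c ∷ []) ⟩
  m * (p - c)        ∎

congruent-sumOfFourSquares-divisible : ∀ M {P} y₁ y₂ y₃ y₄ k₁ k₂ k₃ k₄ →
  (y₁ + M * k₁) * (y₁ + M * k₁) + (y₂ + M * k₂) * (y₂ + M * k₂)
   + (y₃ + M * k₃) * (y₃ + M * k₃) + (y₄ + M * k₄) * (y₄ + M * k₄) ≡ M * P →
  ∃[ R ] y₁ * y₁ + y₂ * y₂ + y₃ * y₃ + y₄ * y₄ ≡ M * R
congruent-sumOfFourSquares-divisible M {P} y₁ y₂ y₃ y₄ k₁ k₂ k₃ k₄ Σx²≡MP =
  P - C , a+m*c≡m*p⇒a≡m*[p-c] {m = M} {c = C} {p = P}
            (trans (sym (expand y₁ y₂ y₃ y₄ k₁ k₂ k₃ k₄ M)) Σx²≡MP)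
  where
  C = (y₁ * k₁ + y₁ * k₁ + M * (k₁ * k₁)) + (y₂ * k₂ + y₂ * k₂ + M * (k₂ * k₂))
      + (y₃ * k₃ + y₃ * k₃ + M * (k₃ * k₃)) + (y₄ * k₄ + y₄ * k₄ + M * (k₄ * k₄))
  expand : ∀ y₁ y₂ y₃ y₄ k₁ k₂ k₃ k₄ M →
    (y₁ + M * k₁) * (y₁ + M * k₁) + (y₂ + M * k₂) * (y₂ + M * k₂)
     + (y₃ + M * k₃) * (y₃ + M * k₃) + (y₄ + M * k₄) * (y₄ + M * k₄)
    ≡ (y₁ * y₁ + y₂ * y₂ + y₃ * y₃ + y₄ * y₄)
      + M * ((y₁ * k₁ + y₁ * k₁ + M * (k₁ * k₁)) + (y₂ * k₂ + y₂ * k₂ + M * (k₂ * k₂))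
           + (y₃ * k₃ + y₃ * k₃ + M * (k₃ * k₃)) + (y₄ * k₄ + y₄ * k₄ + M * (k₄ * k₄)))
  expand = solve-∀

+n≡+m*i⇒i≡+r : ∀ m {n i} .{{_ : ℕ.NonZero m}} → + n ≡ + m * i → ∃[ r ] i ≡ + r × n ≡ m ℕ.* r
+n≡+m*i⇒i≡+r m {n} {i} n≡m*i = ∣ i ∣ , i≡+∣i∣ , n≡m*∣i∣
  where
  n≡m*∣i∣ : n ≡ m ℕ.* ∣ i ∣
  n≡m*∣i∣ = trans (cong ∣_∣ n≡m*i) (ℤₚ.abs-* (+ m) i)
  i≡+∣i∣ : i ≡ + ∣ i ∣
  i≡+∣i∣ = ℤₚ.*-cancelˡ-≡ (+ m) i (+ ∣ i ∣)
    (trans (sym n≡m*i) (trans (cong +_ n≡m*∣i∣) (ℤₚ.pos-* m ∣ i ∣)))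

m*m*k≡m*n⇒m∣n : ∀ m {n} k .{{_ : ℕ.NonZero m}} → + m * + m * k ≡ + m * + n → m ∣ n
m*m*k≡m*n⇒m∣n m {n} k m*m*k≡m*n = divides ∣ k ∣ (begin
  n                      ≡⟨ cong ∣_∣ (ℤₚ.*-cancelˡ-≡ (+ m) (+ n) (+ m * k) (trans (sym m*m*k≡m*n)
                                                                     (ℤₚ.*-assoc (+ m) (+ m) k))) ⟩
  ∣ + m * k ∣            ≡⟨ ℤₚ.abs-* (+ m) k ⟩
  m ℕ.* ∣ k ∣            ≡⟨ ℕₚ.*-comm m ∣ k ∣ ⟩
  ∣ k ∣ ℕ.* m            ∎)

sumOfFourSquares-cong : ∀ {a b c d a′ b′ c′ d′} → a ≡ a′ → b ≡ b′ → c ≡ c′ → d ≡ d′ →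
  a * a + b * b + c * c + d * d ≡ a′ * a′ + b′ * b′ + c′ * c′ + d′ * d′
sumOfFourSquares-cong refl refl refl refl = refl

sumOfFourSquares-zero-residues : ∀ M y₁ y₂ y₃ y₄ k₁ k₂ k₃ k₄ →
  y₁ ≡ 0ℤ → y₂ ≡ 0ℤ → y₃ ≡ 0ℤ → y₄ ≡ 0ℤ →
  (y₁ + M * k₁) * (y₁ + M * k₁) + (y₂ + M * k₂) * (y₂ + M * k₂)
   + (y₃ + M * k₃) * (y₃ + M * k₃) + (y₄ + M * k₄) * (y₄ + M * k₄)
  ≡ M * M * (k₁ * k₁ + k₂ * k₂ + k₃ * k₃ + k₄ * k₄)
sumOfFourSquares-zero-residues M _ _ _ _ k₁ k₂ k₃ k₄ refl refl refl refl = expand M k₁ k₂ k₃ k₄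
  where
  expand : ∀ M k₁ k₂ k₃ k₄ →
    (0ℤ + M * k₁) * (0ℤ + M * k₁) + (0ℤ + M * k₂) * (0ℤ + M * k₂)
     + (0ℤ + M * k₃) * (0ℤ + M * k₃) + (0ℤ + M * k₄) * (0ℤ + M * k₄)
    ≡ M * M * (k₁ * k₁ + k₂ * k₂ + k₃ * k₃ + k₄ * k₄)
  expand = solve-∀

-- Replacing the xᵢ in m p = Σ xᵢ² by residues yᵢ with ∣yᵢ∣ < m / 2 gives Σ yᵢ² = m r with r < m;
-- r = 0 would force m ∣ p.
sumOfFourSquares-descent-odd : ∀ {p m} h → m ≡ suc (suc h ℕ.+ suc h) → Prime p → m ℕ.< p →
  IsSumOfFourSquares (+ m * + p) →
  ∃[ r ] 1 ℕ.≤ r × r ℕ.< m × IsSumOfFourSquares (+ r * + p)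
sumOfFourSquares-descent-odd {p} {m} h m≡2h+3 p-prime m<p (x₁ , x₂ , x₃ , x₄ , Σx²≡mp) =
  descend (residue x₁) (residue x₂) (residue x₃) (residue x₄)
  where
  instance
    m≢0 : ℕ.NonZero m
    m≢0 = subst ℕ.NonZero (sym m≡2h+3) _
    m-nonTrivial : ℕ.NonTrivial m
    m-nonTrivial = subst ℕ.NonTrivial (sym m≡2h+3) _

  residue : ∀ x → SmallResidue m (suc h) x
  residue x = small-residue m (suc h) x (ℕₚ.≤-reflexive m≡2h+3)

  descend : SmallResidue m (suc h) x₁ → SmallResidue m (suc h) x₂ →
            SmallResidue m (suc h) x₃ → SmallResidue m (suc h) x₄ →
            ∃[ r ] 1 ℕ.≤ r × r ℕ.< m × IsSumOfFourSquares (+ r * + p)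
  descend (y₁ , k₁ , x₁≡ , ∣y₁∣≤h) (y₂ , k₂ , x₂≡ , ∣y₂∣≤h)
          (y₃ , k₃ , x₃≡ , ∣y₃∣≤h) (y₄ , k₄ , x₄≡ , ∣y₄∣≤h)
    with Σ[y+mk]²≡mp ← trans (sym (sumOfFourSquares-cong x₁≡ x₂≡ x₃≡ x₄≡)) Σx²≡mp
    with R , Σy²≡mR ←
           congruent-sumOfFourSquares-divisible (+ m) {+ p} y₁ y₂ y₃ y₄ k₁ k₂ k₃ k₄ Σ[y+mk]²≡mp
    with +n≡+m*i⇒i≡+r m (trans (sym (sumOfFourSquares≡sumOfAbsSquares y₁ y₂ y₃ y₄)) Σy²≡mR)
  ... | 0 , _ , Σ∣y∣²≡0 =
    let ∣y₁∣≡0 , ∣y₂∣≡0 , ∣y₃∣≡0 , ∣y₄∣≡0 =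
          sumOfFourSquares≡0 (∣ y₁ ∣) (∣ y₂ ∣) (∣ y₃ ∣) (∣ y₄ ∣) (trans Σ∣y∣²≡0 (ℕₚ.*-zeroʳ m))
        m²K≡mp = trans (sym (sumOfFourSquares-zero-residues (+ m) y₁ y₂ y₃ y₄ k₁ k₂ k₃ k₄
                         (ℤₚ.∣i∣≡0⇒i≡0 ∣y₁∣≡0) (ℤₚ.∣i∣≡0⇒i≡0 ∣y₂∣≡0)
                         (ℤₚ.∣i∣≡0⇒i≡0 ∣y₃∣≡0) (ℤₚ.∣i∣≡0⇒i≡0 ∣y₄∣≡0))) Σ[y+mk]²≡mp
    in contradiction (composite m<p (m*m*k≡m*n⇒m∣n m _ m²K≡mp)) (Prime.notComposite p-prime)
  ... | suc r , refl , Σ∣y∣²≡m[1+r] = suc r , ℕ.s≤s ℕ.z≤n ,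
    ℕₚ.*-cancelˡ-< m (suc r) m (subst₂ ℕ._<_ Σ∣y∣²≡m[1+r] (cong (λ n → n ℕ.* n) (sym m≡2h+3))
      (sumOfFourSquares<square ∣y₁∣≤h ∣y₂∣≤h ∣y₃∣≤h ∣y₄∣≤h)) ,
    sumOfFourSquares-descent-identity (+ m) y₁ y₂ y₃ y₄ k₁ k₂ k₃ k₄ Σ[y+mk]²≡mp Σy²≡mR

even-or-odd : ∀ m → ∃[ h ] (m ≡ h ℕ.+ h ⊎ m ≡ suc (h ℕ.+ h))
even-or-odd 0 = 0 , inj₁ refl
even-or-odd (suc m) with even-or-odd m
... | h , inj₁ refl = h , inj₂ refl
... | h , inj₂ refl = suc h , inj₁ (cong suc (sym (ℕₚ.+-suc h h)))

prime-sumOfFourSquares-descent : ∀ {p} → Prime p → ∀ m → 1 ℕ.≤ m → m ℕ.< p →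
  IsSumOfFourSquares (+ m * + p) → IsSumOfFourSquares (+ p)
prime-sumOfFourSquares-descent {p} p-prime = <-rec _ descend
  where
  descend : ∀ m → (∀ {r} → r ℕ.< m → 1 ℕ.≤ r → r ℕ.< p →
                   IsSumOfFourSquares (+ r * + p) → IsSumOfFourSquares (+ p)) →
            1 ℕ.≤ m → m ℕ.< p → IsSumOfFourSquares (+ m * + p) → IsSumOfFourSquares (+ p)
  descend m recurse 1≤m m<p mp with even-or-odd m
  ... | 0 , inj₁ refl = contradiction 1≤m λ ()
  ... | 0 , inj₂ refl = subst IsSumOfFourSquares (ℤₚ.*-identityˡ (+ p)) mp
  ... | suc h , inj₂ m≡2h+3 =
    let r , 1≤r , r<m , rp = sumOfFourSquares-descent-odd h m≡2h+3 p-prime m<p mp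
    in recurse r<m 1≤r (ℕₚ.<-trans r<m m<p) rp
  ... | suc h , inj₁ m≡2h+2 = recurse h<m (ℕ.s≤s ℕ.z≤n) (ℕₚ.<-trans h<m m<p)
        (sumOfFourSquares-half (+ suc h * + p) (subst IsSumOfFourSquares mp≡2hp mp))
    where
    h<m : suc h ℕ.< m
    h<m = subst (suc h ℕ.<_) (sym m≡2h+2) (ℕₚ.m<m+n (suc h) (ℕ.s≤s ℕ.z≤n))
    mp≡2hp : + m * + p ≡ + 2 * (+ suc h * + p)
    mp≡2hp = begin
      + m * + p                    ≡⟨ cong (λ n → + n * + p) m≡2h+2 ⟩
      + (suc h ℕ.+ suc h) * + p    ≡⟨ cong (_* + p) (ℤₚ.pos-+ (suc h) (suc h)) ⟩
      (+ suc h + + suc h) * + p    ≡⟨ double (+ suc h) (+ p) ⟩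
      + 2 * (+ suc h * + p)        ∎
      where
      double : ∀ a b → (a + a) * b ≡ + 2 * (a * b)
      double = solve-∀

prime-sumOfFourSquares : ∀ {p} → Prime p → IsSumOfFourSquares (+ p)
prime-sumOfFourSquares {p} p-prime with even-or-odd p
... | 0 , inj₁ refl = contradiction p-prime ¬prime[0]
... | 1 , inj₁ refl = 1ℤ , 1ℤ , 0ℤ , 0ℤ , refl
... | suc (suc h) , inj₁ p≡2h+4 =
  contradiction (composite {d = 2} 2<p (divides (suc (suc h)) (begin
    p                               ≡⟨ p≡2h+4 ⟩
    suc (suc h) ℕ.+ suc (suc h)     ≡⟨ cong (suc (suc h) ℕ.+_) (ℕₚ.*-identityʳ (suc (suc h))) ⟨
    suc (suc h) ℕ.+ suc (suc h) ℕ.* 1 ≡⟨ ℕₚ.*-suc (suc (suc h)) 1 ⟨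
    suc (suc h) ℕ.* 2               ∎)))
    (Prime.notComposite p-prime)
  where
  2<p : 2 ℕ.< p
  2<p = subst (2 ℕ.<_) (sym p≡2h+4) (ℕₚ.+-mono-≤ (ℕ.s≤s (ℕ.s≤s ℕ.z≤n)) (ℕ.s≤s ℕ.z≤n))
... | 0 , inj₂ refl = contradiction p-prime ¬prime[1]
... | h@(suc _) , inj₂ p≡2h+1 =
  let x , y , x≤h , y≤h , divides q x²+y²+1≡qp =
        minus-one-sumOfTwoSquares-mod-prime h (subst Prime p≡2h+1 p-prime)
      x²+y²+1≡qp′ = trans x²+y²+1≡qp (cong (q ℕ.*_) (sym p≡2h+1))
  in prime-sumOfFourSquares-descent p-prime q (1≤q x y q x²+y²+1≡qp′) (q<p x≤h y≤h x²+y²+1≡qp′)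
       (+ x , + y , 1ℤ , 0ℤ , (begin
         + x * + x + + y * + y + 1ℤ * 1ℤ + 0ℤ * 0ℤ
           ≡⟨ cong₂ (λ a b → a + b + 1ℤ + 0ℤ) (ℤₚ.pos-* x x) (ℤₚ.pos-* y y) ⟨
         + (x ℕ.* x ℕ.+ y ℕ.* y ℕ.+ 1 ℕ.+ 0)       ≡⟨ cong +_ (trans (ℕₚ.+-identityʳ _) x²+y²+1≡qp′) ⟩
         + (q ℕ.* p)                                ≡⟨ ℤₚ.pos-* q p ⟩
         + q * + p                                  ∎))
  where
  1≤q : ∀ x y q → x ℕ.* x ℕ.+ y ℕ.* y ℕ.+ 1 ≡ q ℕ.* p → 1 ℕ.≤ q
  1≤q x y 0       x²+y²+1≡0 = contradiction (trans (ℕₚ.+-comm 1 _) x²+y²+1≡0) λ ()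
  1≤q x y (suc _) _         = ℕ.s≤s ℕ.z≤n
  q<p : ∀ {x y q} → x ℕ.≤ h → y ℕ.≤ h → x ℕ.* x ℕ.+ y ℕ.* y ℕ.+ 1 ≡ q ℕ.* p → q ℕ.< p
  q<p {x} {y} {q} x≤h y≤h x²+y²+1≡qp = ℕₚ.*-cancelʳ-< p q p
    (subst₂ ℕ._<_ x²+y²+1≡qp (cong (λ n → n ℕ.* n) (sym p≡2h+1))
      (ℕₚ.≤-<-trans (ℕₚ.m≤m+n _ 0) (sumOfFourSquares<square x≤h y≤h (ℕ.s≤s ℕ.z≤n) ℕ.z≤n)))

productOfPrimes-sumOfFourSquares : ∀ {ps} → All Prime ps → IsSumOfFourSquares (+ product ps)
productOfPrimes-sumOfFourSquares All.[]                    = 1ℤ , 0ℤ , 0ℤ , 0ℤ , refl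
productOfPrimes-sumOfFourSquares {p ∷ ps} (p-prime All.∷ ps-prime) =
  subst IsSumOfFourSquares (sym (ℤₚ.pos-* p (product ps)))
    (sumOfFourSquares-* {+ p} {+ product ps} (prime-sumOfFourSquares p-prime) (productOfPrimes-sumOfFourSquares ps-prime))

lagrange-four-square : ∀ N → IsSumOfFourSquares (+ N)
lagrange-four-square 0           = 0ℤ , 0ℤ , 0ℤ , 0ℤ , refl
lagrange-four-square N@(suc _)   =
  subst (IsSumOfFourSquares ∘ +_) (sym isFactorisation) (productOfPrimes-sumOfFourSquares factorsPrime)
  where open PrimeFactorisation (factorise N)

-- Quadratic forms of orthogonal sums

ΣFin-cong : ∀ k {f g : Fin k → ℤ} → (∀ i → f i ≡ g i) → ΣFin k f ≡ ΣFin k g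
ΣFin-cong 0       f≗g = refl
ΣFin-cong (suc k) f≗g = cong₂ _+_ (f≗g zero) (ΣFin-cong k (f≗g ∘ suc))

ΣFin-0 : ∀ k {f : Fin k → ℤ} → (∀ i → f i ≡ 0ℤ) → ΣFin k f ≡ 0ℤ
ΣFin-0 0       f≡0 = refl
ΣFin-0 (suc k) f≡0 = cong₂ _+_ (f≡0 zero) (ΣFin-0 k (f≡0 ∘ suc))

ΣFin-++ : ∀ a b (f : Fin (a ℕ.+ b) → ℤ) →
  ΣFin (a ℕ.+ b) f ≡ ΣFin a (f ∘ (_↑ˡ b)) + ΣFin b (f ∘ (a ↑ʳ_))
ΣFin-++ 0       b f = sym (ℤₚ.+-identityˡ _)
ΣFin-++ (suc a) b f = trans (cong (λ s → f zero + s) (ΣFin-++ a b (f ∘ suc)))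
                            (sym (ℤₚ.+-assoc (f zero) _ _))

Q-cong : ∀ {k} (G : Gram k) {x y : Vector ℤ k} → (∀ i → x i ≡ y i) → Q G x ≡ Q G y
Q-cong {k} G x≗y =
  ΣFin-cong k λ i → ΣFin-cong k λ j → cong (G i j *_) (cong₂ _*_ (x≗y i) (x≗y j))

Q-0 : ∀ {k} (G : Gram k) {x : Vector ℤ k} → (∀ i → x i ≡ 0ℤ) → Q G x ≡ 0ℤ
Q-0 {k} G {x} x≡0 = ΣFin-0 k λ i → ΣFin-0 k λ j →
  trans (cong (λ z → G i j * (z * x j)) (x≡0 i)) (ℤₚ.*-zeroʳ (G i j))

module _ {a b : ℕ} (G : Gram a) (H : Gram b) where

  ⊥-↑ˡ-↑ˡ : ∀ i j → (G ⊥ H) (i ↑ˡ b) (j ↑ˡ b) ≡ G i j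
  ⊥-↑ˡ-↑ˡ i j rewrite Finₚ.splitAt-↑ˡ a i b | Finₚ.splitAt-↑ˡ a j b = refl

  ⊥-↑ˡ-↑ʳ : ∀ i j → (G ⊥ H) (i ↑ˡ b) (a ↑ʳ j) ≡ 0ℤ
  ⊥-↑ˡ-↑ʳ i j rewrite Finₚ.splitAt-↑ˡ a i b | Finₚ.splitAt-↑ʳ a b j = refl

  ⊥-↑ʳ-↑ˡ : ∀ i j → (G ⊥ H) (a ↑ʳ i) (j ↑ˡ b) ≡ 0ℤ
  ⊥-↑ʳ-↑ˡ i j rewrite Finₚ.splitAt-↑ʳ a b i | Finₚ.splitAt-↑ˡ a j b = refl

  ⊥-↑ʳ-↑ʳ : ∀ i j → (G ⊥ H) (a ↑ʳ i) (a ↑ʳ j) ≡ H i j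
  ⊥-↑ʳ-↑ʳ i j rewrite Finₚ.splitAt-↑ʳ a b i | Finₚ.splitAt-↑ʳ a b j = refl

  ⊥-symmetric : (∀ i j → G i j ≡ G j i) → (∀ i j → H i j ≡ H j i) →
                ∀ i j → (G ⊥ H) i j ≡ (G ⊥ H) j i
  ⊥-symmetric G-sym H-sym i j with splitAt a i | splitAt a j
  ... | inj₁ i′ | inj₁ j′ = G-sym i′ j′
  ... | inj₂ i′ | inj₂ j′ = H-sym i′ j′
  ... | inj₁ _  | inj₂ _  = refl
  ... | inj₂ _  | inj₁ _  = refl

  Q-⊥ : ∀ x → Q (G ⊥ H) x ≡ Q G (take a x) + Q H (drop a x)
  Q-⊥ x = trans (ΣFin-++ a b row) (cong₂ _+_ (ΣFin-cong a row-↑ˡ) (ΣFin-cong b row-↑ʳ))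
    where
    row : Fin (a ℕ.+ b) → ℤ
    row i = ΣFin (a ℕ.+ b) (λ j → (G ⊥ H) i j * (x i * x j))
    row-↑ˡ : ∀ i → row (i ↑ˡ b) ≡ ΣFin a (λ j → G i j * (take a x i * take a x j))
    row-↑ˡ i = begin
      row (i ↑ˡ b)                                            ≡⟨ ΣFin-++ a b _ ⟩
      ΣFin a (λ j → (G ⊥ H) (i ↑ˡ b) (j ↑ˡ b) * _)
        + ΣFin b (λ j → (G ⊥ H) (i ↑ˡ b) (a ↑ʳ j) * _)       ≡⟨ cong₂ _+_
                                                                   (ΣFin-cong a λ j → cong (_* _) (⊥-↑ˡ-↑ˡ i j))
                                                                   (ΣFin-0 b λ j → cong (_* _) (⊥-↑ˡ-↑ʳ i j)) ⟩
      ΣFin a (λ j → G i j * (take a x i * take a x j)) + 0ℤ  ≡⟨ ℤₚ.+-identityʳ _ ⟩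
      ΣFin a (λ j → G i j * (take a x i * take a x j))       ∎
    row-↑ʳ : ∀ i → row (a ↑ʳ i) ≡ ΣFin b (λ j → H i j * (drop a x i * drop a x j))
    row-↑ʳ i = begin
      row (a ↑ʳ i)                                            ≡⟨ ΣFin-++ a b _ ⟩
      ΣFin a (λ j → (G ⊥ H) (a ↑ʳ i) (j ↑ˡ b) * _)
        + ΣFin b (λ j → (G ⊥ H) (a ↑ʳ i) (a ↑ʳ j) * _)       ≡⟨ cong₂ _+_
                                                                   (ΣFin-0 a λ j → cong (_* _) (⊥-↑ʳ-↑ˡ i j))
                                                                   (ΣFin-cong b λ j → cong (_* _) (⊥-↑ʳ-↑ʳ i j)) ⟩
      0ℤ + ΣFin b (λ j → H i j * (drop a x i * drop a x j))  ≡⟨ ℤₚ.+-identityˡ _ ⟩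
      ΣFin b (λ j → H i j * (drop a x i * drop a x j))       ∎

  Q-⊥-++ : ∀ u v → Q (G ⊥ H) (u ++ v) ≡ Q G u + Q H v
  Q-⊥-++ u v = trans (Q-⊥ (u ++ v))
    (cong₂ _+_ (Q-cong G (lookup-++ˡ u v)) (Q-cong H (lookup-++ʳ u v)))

take-drop-0⇒0 : ∀ a {b} (x : Vector ℤ (a ℕ.+ b)) →
  (∀ i → take a x i ≡ 0ℤ) → (∀ j → drop a x j ≡ 0ℤ) → ∀ i → x i ≡ 0ℤ
take-drop-0⇒0 a x take≡0 drop≡0 i with splitAt a i in eq
... | inj₁ j = subst (λ i → x i ≡ 0ℤ) (Finₚ.splitAt⁻¹-↑ˡ eq) (take≡0 j)
... | inj₂ j = subst (λ i → x i ≡ 0ℤ) (Finₚ.splitAt⁻¹-↑ʳ eq) (drop≡0 j)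

sumOfSquares : ∀ {k} → Vector ℤ k → ℤ
sumOfSquares {k} u = ΣFin k (λ i → u i * u i)

sumOfSquares-nonNeg : ∀ {k} (u : Vector ℤ k) → ∃[ s ] sumOfSquares u ≡ + s
sumOfSquares-nonNeg {0}     u = 0 , refl
sumOfSquares-nonNeg {suc k} u with sumOfSquares-nonNeg (u ∘ suc)
... | s , rest≡s = ∣ u zero ∣ ℕ.* ∣ u zero ∣ ℕ.+ s , cong₂ _+_ (i*i≡+∣i∣*∣i∣ (u zero)) rest≡s

sumOfSquares-pos : ∀ {k} (u : Vector ℤ k) → NonZeroVec u → ∃[ s ] sumOfSquares u ≡ + suc s
sumOfSquares-pos {0}     u u≢0 = contradiction (λ ()) u≢0
sumOfSquares-pos {suc k} u u≢0 with u zero ℤ.≟ 0ℤ | sumOfSquares-nonNeg (u ∘ suc)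
... | no u₀≢0 | s , rest≡s = ℕ.pred ∣u₀∣² ℕ.+ s , (begin
  u zero * u zero + sumOfSquares (u ∘ suc)  ≡⟨ cong₂ _+_ (i*i≡+∣i∣*∣i∣ (u zero)) rest≡s ⟩
  + (∣u₀∣² ℕ.+ s)                           ≡⟨ cong (λ t → + (t ℕ.+ s)) (ℕₚ.suc-pred ∣u₀∣²) ⟨
  + suc (ℕ.pred ∣u₀∣² ℕ.+ s)                ∎)
  where
  ∣u₀∣² = ∣ u zero ∣ ℕ.* ∣ u zero ∣
  instance
    ∣u₀∣²≢0 : ℕ.NonZero ∣u₀∣²
    ∣u₀∣²≢0 = ℕₚ.m*n≢0 _ _ {{ℤ.≢-nonZero u₀≢0}} {{ℤ.≢-nonZero u₀≢0}}
... | yes u₀≡0 | _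
  with sumOfSquares-pos (u ∘ suc) (λ rest≡0 → u≢0 λ { zero → u₀≡0 ; (suc i) → rest≡0 i })
...   | s , rest≡1+s = s , (begin
  u zero * u zero + sumOfSquares (u ∘ suc)  ≡⟨ cong₂ (λ a b → a * a + b) u₀≡0 rest≡1+s ⟩
  0ℤ * 0ℤ + + suc s                         ≡⟨⟩
  + suc s                                   ∎)

Q-diag4 : ∀ m (u : Vector ℤ 4) → Q (diag4 m) u ≡ m * sumOfSquares u
Q-diag4 m u = expand m (u zero) (u (suc zero)) (u (suc (suc zero))) (u (suc (suc (suc zero))))
  where
  expand : ∀ m a b c d →
    (m * (a * a) + (0ℤ * (a * b) + (0ℤ * (a * c) + (0ℤ * (a * d) + 0ℤ))))
    + ((0ℤ * (b * a) + (m * (b * b) + (0ℤ * (b * c) + (0ℤ * (b * d) + 0ℤ))))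
    + ((0ℤ * (c * a) + (0ℤ * (c * b) + (m * (c * c) + (0ℤ * (c * d) + 0ℤ))))
    + ((0ℤ * (d * a) + (0ℤ * (d * b) + (0ℤ * (d * c) + (m * (d * d) + 0ℤ)))) + 0ℤ)))
    ≡ m * (a * a + (b * b + (c * c + (d * d + 0ℤ))))
  expand = solve-∀

diag4-symmetric : ∀ m i j → diag4 m i j ≡ diag4 m j i
diag4-symmetric m i j with i Fin.≟ j | j Fin.≟ i
... | yes _   | yes _   = refl
... | no  _   | no  _   = refl
... | yes i≡j | no  j≢i = contradiction (sym i≡j) j≢i
... | no  i≢j | yes j≡i = contradiction (sym j≡i) i≢j

reassociate : ∀ a b c d → a * a + (b * b + (c * c + (d * d + 0ℤ))) ≡ a * a + b * b + c * c + d * d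
reassociate = solve-∀

sumOfFourSquares⇒sumOfSquares : ∀ {N} → IsSumOfFourSquares N → ∃[ u ] sumOfSquares {4} u ≡ N
sumOfFourSquares⇒sumOfSquares (a , b , c , d , Σ≡N) =
  (a Vector.∷ b Vector.∷ c Vector.∷ d Vector.∷ Vector.[]) , trans (reassociate a b c d) Σ≡N

≥-decomposition : ∀ n {m} .{{_ : ℕ.NonZero n}} → n ℕ.≤ m →
  ∃[ a ] ∃[ b ] m ≡ n ℕ.* a ℕ.+ b × (b ≡ 0 ⊎ n ℕ.< b × b ℕ.< n ℕ.+ n)
≥-decomposition n {m} n≤m = decompose (m % n) (m / n) (m≡m%n+[m/n]*n m n) (m%n<n m n)
  where
  regroup₀ : ∀ n q → 0 ℕ.+ q ℕ.* n ≡ n ℕ.* q ℕ.+ 0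
  regroup₀ = ℕ-solve-∀
  regroup : ∀ n q r → r ℕ.+ (n ℕ.+ q ℕ.* n) ≡ n ℕ.* q ℕ.+ (n ℕ.+ r)
  regroup = ℕ-solve-∀

  decompose : ∀ r q → m ≡ r ℕ.+ q ℕ.* n → r ℕ.< n →
    ∃[ a ] ∃[ b ] m ≡ n ℕ.* a ℕ.+ b × (b ≡ 0 ⊎ n ℕ.< b × b ℕ.< n ℕ.+ n)
  decompose 0       q       m≡qn    _   = q , 0 , trans m≡qn (regroup₀ n q) , inj₁ refl
  decompose (suc r) 0       m≡1+r   r<n = contradiction (subst (n ℕ.≤_) m≡1+r n≤m)
                                            (ℕₚ.<⇒≱ (subst (ℕ._< n) (sym (ℕₚ.+-identityʳ (suc r))) r<n))
  decompose (suc r) (suc q) m≡r+qn  r<n = q , n ℕ.+ suc r , trans m≡r+qn (regroup n q (suc r)) ,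
    inj₂ (ℕₚ.m<m+n n (ℕ.s≤s ℕ.z≤n) , ℕₚ.+-monoʳ-< n r<n)

module _ (n : ℕ) {k : ℕ} (L : Gram k) where

  Q-diag4-⊥ : ∀ x → Q (diag4 (+ n) ⊥ L) x ≡ + n * sumOfSquares (take 4 x) + Q L (drop 4 x)
  Q-diag4-⊥ x = trans (Q-⊥ (diag4 (+ n)) L x) (cong (_+ Q L (drop 4 x)) (Q-diag4 (+ n) (take 4 x)))

  diag4-⊥-≥ : (∀ y → NonZeroVec y → + n ≤ Q L y) → ∀ x → NonZeroVec x → + n ≤ Q (diag4 (+ n) ⊥ L) x
  diag4-⊥-≥ L≥n x x≢0 with Finₚ.all? (λ j → drop 4 x j ℤ.≟ 0ℤ)
  ... | no y≢0 =
    let s , Σu²≡s = sumOfSquares-nonNeg (take 4 x)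
    in subst (+ n ≤_) (sym (trans (Q-diag4-⊥ x) (cong (λ t → + n * t + Q L (drop 4 x)) Σu²≡s)))
         (subst (λ t → + n ≤ t + Q L (drop 4 x)) (ℤₚ.pos-* n s)
           (ℤₚ.i≤j⇒i≤k+j (+ (n ℕ.* s)) (L≥n _ y≢0)))
  ... | yes y≡0 =
    let s , Σu²≡1+s = sumOfSquares-pos (take 4 x) (λ u≡0 → x≢0 (take-drop-0⇒0 4 x u≡0 y≡0))
    in subst (+ n ≤_) (sym (begin
         Q (diag4 (+ n) ⊥ L) x                                    ≡⟨ Q-diag4-⊥ x ⟩
         + n * sumOfSquares (take 4 x) + Q L (drop 4 x)          ≡⟨ cong₂ (λ t z → + n * t + z) Σu²≡1+s (Q-0 L y≡0) ⟩
         + n * + suc s + 0ℤ                                       ≡⟨ ℤₚ.+-identityʳ _ ⟩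
         + n * + suc s                                            ≡⟨ ℤₚ.pos-* n (suc s) ⟨
         + (n ℕ.* suc s)                                          ∎))
       (+≤+ (ℕₚ.m≤m*n n (suc s)))

  represented⇒≥ : (∀ y → NonZeroVec y → + n ≤ Q L y) →
    ∀ m → ¬ m ≡ 0ℤ → Represents (diag4 (+ n) ⊥ L) m → + n ≤ m
  represented⇒≥ L≥n m m≢0 (x , Qx≡m) =
    subst (+ n ≤_) Qx≡m (diag4-⊥-≥ L≥n x λ x≡0 → m≢0 (trans (sym Qx≡m) (Q-0 (diag4 (+ n) ⊥ L) x≡0)))

  ≥⇒represented : .{{_ : ℕ.NonZero n}} →
    (∀ b → n ℕ.< b → b ℕ.< n ℕ.+ n → Represents L (+ b)) →
    ∀ m → + n ≤ m → Represents (diag4 (+ n) ⊥ L) m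
  ≥⇒represented represents-gap (+ m) (+≤+ n≤m) =
    let a , b , m≡na+b , b-in-gap = ≥-decomposition n n≤m
        u , Σu²≡a = sumOfFourSquares⇒sumOfSquares (lagrange-four-square a)
        y , Qy≡b  = gap-represented b b-in-gap
    in u ++ y , (begin
      Q (diag4 (+ n) ⊥ L) (u ++ y)       ≡⟨ Q-⊥-++ (diag4 (+ n)) L u y ⟩
      Q (diag4 (+ n)) u + Q L y          ≡⟨ cong₂ _+_ (trans (Q-diag4 (+ n) u) (cong (+ n *_) Σu²≡a)) Qy≡b ⟩
      + n * + a + + b                    ≡⟨ cong (_+ + b) (ℤₚ.pos-* n a) ⟨
      + (n ℕ.* a ℕ.+ b)                  ≡⟨ cong +_ m≡na+b ⟨
      + m                                ∎)
    where
    gap-represented : ∀ b → b ≡ 0 ⊎ n ℕ.< b × b ℕ.< n ℕ.+ n → Represents L (+ b)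
    gap-represented b (inj₁ refl)           = (λ _ → 0ℤ) , Q-0 L (λ _ → refl)
    gap-represented b (inj₂ (n<b , b<2n)) = represents-gap b n<b b<2n

min≡n⊎n+1⇒≥n : ∀ n {k} (L : Gram k) → IsMin L (+ n) ⊎ IsMin L (+ n + + 1) →
  ∀ y → NonZeroVec y → + n ≤ Q L y
min≡n⊎n+1⇒≥n n L (inj₁ (_ , min≤)) y y≢0 = min≤ y y≢0
min≡n⊎n+1⇒≥n n L (inj₂ (_ , min≤)) y y≢0 = ℤₚ.≤-trans (+≤+ (ℕₚ.m≤m+n n 1)) (min≤ y y≢0)

lemma3p2 : (n : ℕ) → 1 Data.Nat.≤ n → (k : ℕ) → (L : Gram k) → IsZLattice L
    → (IsMin L (+ n) ⊎ IsMin L (+ n + + 1))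
    → (∀ (m : ℤ) → + n + + 1 ≤ m → m ≤ + 2 * + n - + 1 → Represents L m)
    → TightUniversal (+ n) (diag4 (+ n) ⊥ L) × t≤ (+ n) (k +ℕ 4)
lemma3p2 n@(suc n-1) _ k L L-lattice min-L represents-L =
  tight , 4 +ℕ k , ℕₚ.≤-reflexive (ℕₚ.+-comm 4 k) , diag4 (+ n) ⊥ L , lattice , tight
  where
  L≥n : ∀ y → NonZeroVec y → + n ≤ Q L y
  L≥n = min≡n⊎n+1⇒≥n n L min-L

  -- At x = + n-1 the two sides compute to + 2 * + n - + 1 and + (n-1 ℕ.+ n).
  twice-minus-one : ∀ x → + 2 * (+ 1 + x) - + 1 ≡ x + (+ 1 + x)
  twice-minus-one = solve-∀

  represents-gap : ∀ b → n ℕ.< b → b ℕ.< n ℕ.+ n → Represents L (+ b)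
  represents-gap b n<b b<2n = represents-L (+ b)
    (+≤+ (subst (ℕ._≤ b) (ℕₚ.+-comm 1 n) n<b))
    (subst (+ b ≤_) (sym (twice-minus-one (+ n-1))) (+≤+ (ℕ.s≤s⁻¹ b<2n)))

  lattice : IsZLattice (diag4 (+ n) ⊥ L)
  lattice = record
    { symmetric = ⊥-symmetric (diag4 (+ n)) L (diag4-symmetric (+ n)) (IsZLattice.symmetric L-lattice)
    ; posDef    = λ x x≢0 → ℤₚ.<-≤-trans (+<+ (ℕ.s≤s ℕ.z≤n)) (diag4-⊥-≥ n L L≥n x x≢0)
    }

  tight : TightUniversal (+ n) (diag4 (+ n) ⊥ L)
  tight m m≢0 = mk⇔ (represented⇒≥ n L L≥n m m≢0) (≥⇒represented n L represents-gap m)
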